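{- Let $G$ be a graph, $t \in \mathbb{N}$, and $H$ a nonempty connected subgraph of $G$ such that the graph obtained from $G[N_G[H]]$ by adding all edges between pairs of vertices of $N_G(H)$ has treewidth at most $2$. Let $G'$ be obtained from $G$ by deleting $V(H)$ and adding all edges between pairs of vertices of $N_G(H)$. Then $\mathrm{TW2D}(G) \le t$ if and only if $\mathrm{TW2D}(G') \le t$.
   Context: Graphs are finite, simple, undirected; $\mathrm{tw}$ is treewidth. $N_G(H)$ is the set of vertices outside $V(H)$ adjacent to a vertex of $H$, and $N_G[H]=N_G(H)\cup V(H)$. $\mathrm{TW2D}(G)$ is the minimum size of $S \subseteq V(G)$ with $\mathrm{tw}(G-S)\le 2$. -}

module Defs where

open import Data.Nat using (ℕ; suc; _≤_)
open import Data.Fin using (Fin)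
open import Data.Fin.Subset using (Subset; _∈_; _∉_; ∣_∣)
open import Data.List using (List; []; _∷_; length)
open import Data.List.Relation.Unary.Unique.Propositional using (Unique)
open import Data.List.Relation.Unary.Linked using (Linked)
open import Data.Product using (Σ; ∃; _×_; _,_)
open import Data.Sum using (_⊎_; inj₁; inj₂)
open import Data.Empty using (⊥)
open import Relation.Nullary using (¬_)
open import Relation.Binary.PropositionalEquality using (_≡_; _≢_; sym)

-- Finite simple undirected graphs.  A graph with at most n vertices is
-- given by a vertex set V ⊆ Fin n and a symmetric irreflexive edge
-- relation E whose endpoints lie in V.

record Graph (n : ℕ) : Set₁ where
  field
    V     : Fin n → Set
    E     : Fin n → Fin n → Set
    E-sym : ∀ {u v} → E u v → E v u
    E-irr : ∀ {u} → E u u → ⊥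
    E-V   : ∀ {u v} → E u v → V u

open Graph public

data WalkIn {m : ℕ} (A : Fin m → Fin m → Set) (P : Fin m → Set) :
            Fin m → Fin m → Set where
  here : ∀ {u} → P u → WalkIn A P u u
  step : ∀ {u w v} → P u → A u w → WalkIn A P w v → WalkIn A P u v

SubgraphOf : ∀ {n} → Graph n → Graph n → Set
SubgraphOf H G = (∀ {x} → V H x → V G x) × (∀ {u v} → E H u v → E G u v)

NonEmpty : ∀ {n} → Graph n → Set
NonEmpty G = ∃ λ x → V G x

Connected : ∀ {n} → Graph n → Set
Connected G = ∀ {u v} → V G u → V G v → WalkIn (E G) (V G) u v

lastOf : ∀ {m} → Fin m → List (Fin m) → Fin m
lastOf x []       = x
lastOf x (y ∷ ys) = lastOf y ys

HasCycle : ∀ {m} → (Fin m → Fin m → Set) → Set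
HasCycle {m} A = Σ (Fin m) λ x → Σ (List (Fin m)) λ xs →
  (3 ≤ length (x ∷ xs)) × Unique (x ∷ xs) × Linked A (x ∷ xs) × A (lastOf x xs) x

record Tree : Set₁ where
  field
    m         : ℕ
    Adj       : Fin m → Fin m → Set
    Adj-sym   : ∀ {i j} → Adj i j → Adj j i
    Adj-irr   : ∀ {i} → Adj i i → ⊥
    nonempty  : Fin m
    connected : ∀ (i j : Fin m) → WalkIn Adj (λ _ → Fin m) i j
    acyclic   : ¬ HasCycle Adj

record TreeDecomposition {n : ℕ} (G : Graph n) : Set₁ where
  field
    T        : Tree
    bag      : Fin (Tree.m T) → Subset n
    bag-V    : ∀ i {x} → x ∈ bag i → V G x
    cover-V  : ∀ {x} → V G x → ∃ λ i → x ∈ bag i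
    cover-E  : ∀ {u v} → E G u v → ∃ λ i → u ∈ bag i × v ∈ bag i
    coherent : ∀ x {i j} → x ∈ bag i → x ∈ bag j →
               WalkIn (Tree.Adj T) (λ k → x ∈ bag k) i j

  width≤ : ℕ → Set
  width≤ k = ∀ i → ∣ bag i ∣ ≤ suc k

TW≤ : ∀ {n} → Graph n → ℕ → Set₁
TW≤ G k = Σ (TreeDecomposition G) λ D → TreeDecomposition.width≤ D k

delete : ∀ {n} → Graph n → Subset n → Graph n
delete G S = record
  { V     = λ x → V G x × x ∉ S
  ; E     = λ u v → E G u v × u ∉ S × v ∉ S
  ; E-sym = λ { (e , a , b) → E-sym G e , b , a }
  ; E-irr = λ { (e , _ , _) → E-irr G e }
  ; E-V   = λ { (e , a , _) → E-V G e , a }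
  }

-- TW2D(G) ≤ t  (the minimum over S is at most t iff some S of size ≤ t works)
TW2D≤ : ∀ {n} → Graph n → ℕ → Set₁
TW2D≤ {n} G t = Σ (Subset n) λ S →
  (∀ {x} → x ∈ S → V G x) × ∣ S ∣ ≤ t × TW≤ (delete G S) 2

Nbh : ∀ {n} → Graph n → Graph n → Fin n → Set
Nbh G H x = V G x × ¬ V H x × ∃ λ y → V H y × E G x y

torso : ∀ {n} → Graph n → Graph n → Graph n
torso G H = record
  { V     = Vt
  ; E     = Et
  ; E-sym = λ { (inj₁ (e , a , b)) → inj₁ (E-sym G e , b , a)
              ; (inj₂ (a , b , ne)) → inj₂ (b , a , λ eq → ne (sym eq)) }
  ; E-irr = λ { (inj₁ (e , _ , _)) → E-irr G e
              ; (inj₂ (_ , _ , ne)) → ne _≡_.refl }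
  ; E-V   = λ { (inj₁ (_ , a , _)) → a ; (inj₂ (a , _ , _)) → inj₂ a }
  }
  where
  Vt : _ → Set
  Vt x = V H x ⊎ Nbh G H x
  Et : _ → _ → Set
  Et u v = (E G u v × Vt u × Vt v) ⊎ (Nbh G H u × Nbh G H v × u ≢ v)

reduce : ∀ {n} → Graph n → Graph n → Graph n
reduce G H = record
  { V     = Vr
  ; E     = Er
  ; E-sym = λ { (inj₁ (e , a , b)) → inj₁ (E-sym G e , b , a)
              ; (inj₂ (a , b , ne)) → inj₂ (b , a , λ eq → ne (sym eq)) }
  ; E-irr = λ { (inj₁ (e , _ , _)) → E-irr G e
              ; (inj₂ (_ , _ , ne)) → ne _≡_.refl }
  ; E-V   = λ { (inj₁ (_ , a , _)) → a
              ; (inj₂ ((gv , nh , _) , _ , _)) → gv , nh }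
  }
  where
  Vr : _ → Set
  Vr x = V G x × ¬ V H x
  Er : _ → _ → Set
  Er u v = (E G u v × Vr u × Vr v) ⊎ (Nbh G H u × Nbh G H v × u ≢ v)

-- In the torso, N(H) is a clique and V(H) is a connected set adjacent to all of it, so three
-- vertices of N(H) would form a K₄ minor; in a decomposition of width 2 the Helly property of
-- subtrees turns this into a bag of size 4.  Hence |N(H)| ≤ 2.  Given S with tw(G − S) ≤ 2, a set
-- for G′ of no larger size is obtained as follows: if S meets V(H), replace S ∩ V(H) by one
-- neighbour; if S avoids V(H) but not N(H), keep S and contract V(H) into a surviving neighbour;
-- otherwise take S ∖ V(H), for which G′ − S′ is a subgraph of G − S.  Conversely, a set S for G′
-- works for G: glue the torso decomposition, restricted to the complement of S, to a decomposition
-- of G′ − S along an edge joining two bags that contain the at most two vertices of N(H) ∖ S.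

module Submission where

open import Defs

open import Data.Nat using (ℕ; suc; _+_; _≤_; s≤s; z≤n)
open import Data.Nat.Properties using (≤-trans; m≤n⇒m≤1+n; module ≤-Reasoning)
open import Data.Bool using (true)
open import Data.Fin using (Fin; suc; _≟_; splitAt; join)
open import Data.Fin.Subset using (Subset; _∈_; _∉_; ∣_∣; inside; outside; _⊆_; _-_; ⁅_⁆)
open import Data.Fin.Subset.Properties using (p⊆q⇒∣p∣≤∣q∣; x∈p∧x∉q⇒x∈p─q; x∈⁅y⁆⇒x≡y; p─⊥≡p; _∈?_; p─q⊆p)
open import Data.Fin.Properties using (any?; splitAt-join; join-splitAt)
open import Relation.Nullary.Decidable using (dec-true; decidable-stable; _×-dec_; _⊎-dec_; ¬?)
open import Data.Vec using (_∷_; []; here; there; tabulate)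
open import Data.Vec.Properties using (lookup∘tabulate; lookup⇒[]=; []=⇒lookup)
import Data.List as List
import Data.List.Properties as List
open import Data.List using (List; []; _∷_; length; _++_)
open import Data.List.Membership.Propositional using () renaming (_∈_ to _∈ₗ_; _∉_ to _∉ₗ_)
open import Data.List.Membership.Propositional.Properties using (∈-∃++)
open import Data.List.Relation.Unary.Any using (here; there)
open import Data.List.Relation.Unary.Linked using (Linked; [-]; _∷_)
import Data.List.Relation.Unary.All.Properties as AllP
import Data.List.Relation.Unary.Unique.Propositional.Properties as Unique
import Data.List.Relation.Unary.Linked.Properties as Linked
open import Data.List.Relation.Unary.All as All using (All; []; _∷_)
open import Data.List.Relation.Unary.AllPairs as AllPairs using ([]; _∷_)
open import Data.List.Relation.Unary.Unique.Propositional using (Unique)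
import Data.Product as Product
open import Data.Product using (Σ; ∃; _×_; _,_; proj₁; proj₂)
open import Data.Sum as Sum using (_⊎_; inj₁; inj₂)
open import Data.Empty using (⊥; ⊥-elim)
open import Data.Unit using (⊤; tt)
open import Function using (_∘_; id)
open import Relation.Nullary using (¬_; Dec; yes; no; does)
open import Relation.Unary using (Decidable)
open import Relation.Binary.PropositionalEquality
  using (_≡_; _≢_; refl; sym; trans; cong; subst; subst₂; module ≡-Reasoning)

subset : ∀ {n} {P : Fin n → Set} → Decidable P → Subset n
subset P? = tabulate (does ∘ P?)

∈-subset⁺ : ∀ {n} {P : Fin n → Set} (P? : Decidable P) {x} → P x → x ∈ subset P?
∈-subset⁺ P? {x} px = lookup⇒[]= x _ (trans (lookup∘tabulate _ x) (dec-true (P? x) px))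

∈-subset⁻ : ∀ {n} {P : Fin n → Set} (P? : Decidable P) {x} → x ∈ subset P? → P x
∈-subset⁻ P? {x} x∈ = yes⇒ (P? x) (trans (sym (lookup∘tabulate _ x)) ([]=⇒lookup x∈))
  where
  yes⇒ : ∀ {A : Set} (a? : Dec A) → does a? ≡ true → A
  yes⇒ (yes a) _ = a

x∈p⇒∣p∣≡1+∣p-x∣ : ∀ {n} {p : Subset n} {x} → x ∈ p → ∣ p ∣ ≡ suc ∣ p - x ∣
x∈p⇒∣p∣≡1+∣p-x∣ {p = inside ∷ p} here = cong suc (cong ∣_∣ (sym (p─⊥≡p p)))
x∈p⇒∣p∣≡1+∣p-x∣ {p = inside ∷ p} (there x∈p) = cong suc (x∈p⇒∣p∣≡1+∣p-x∣ x∈p)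
x∈p⇒∣p∣≡1+∣p-x∣ {p = outside ∷ p} (there x∈p) = x∈p⇒∣p∣≡1+∣p-x∣ x∈p

x∈p∧x≢y⇒x∈p-y : ∀ {n} {p : Subset n} {x y} → x ∈ p → x ≢ y → x ∈ p - y
x∈p∧x≢y⇒x∈p-y {y = y} x∈p x≢y = x∈p∧x∉q⇒x∈p─q x∈p (x≢y ∘ x∈⁅y⁆⇒x≡y y)

x∉p-x : ∀ {n} {p : Subset n} x → x ∉ p - x
x∉p-x {p = _ ∷ _} (suc x) (there x∈p-x) = x∉p-x x x∈p-x

∣p∣≤1+∣q∣ : ∀ {n} {p q : Subset n} {x} → (∀ {y} → y ∈ p → y ∈ q ⊎ y ≡ x) → ∣ p ∣ ≤ suc ∣ q ∣
∣p∣≤1+∣q∣ {p = p} {q} {x} p⊆q∪x with x ∈? p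
... | no x∉p = m≤n⇒m≤1+n (p⊆q⇒∣p∣≤∣q∣ (λ y∈p → Sum.[ id , (λ { refl → ⊥-elim (x∉p y∈p) }) ]′ (p⊆q∪x y∈p)))
... | yes x∈p = begin
  ∣ p ∣          ≡⟨ x∈p⇒∣p∣≡1+∣p-x∣ x∈p ⟩
  suc ∣ p - x ∣  ≤⟨ s≤s (p⊆q⇒∣p∣≤∣q∣ p-x⊆q) ⟩
  suc ∣ q ∣      ∎
  where
  open ≤-Reasoning
  p-x⊆q : p - x ⊆ q
  p-x⊆q {y} y∈p-x with p⊆q∪x (p─q⊆p p ⁅ x ⁆ y∈p-x)
  ... | inj₁ y∈q = y∈q
  ... | inj₂ refl = ⊥-elim (x∉p-x y y∈p-x)

p⊆q-x∪⁅y⁆⇒∣p∣≤∣q∣ : ∀ {n} {p q : Subset n} {x y} → x ∈ q →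
                     (∀ {z} → z ∈ p → (z ∈ q × z ≢ x) ⊎ z ≡ y) → ∣ p ∣ ≤ ∣ q ∣
p⊆q-x∪⁅y⁆⇒∣p∣≤∣q∣ {p = p} {q} {x} x∈q p⊆ = begin
  ∣ p ∣          ≤⟨ ∣p∣≤1+∣q∣ (Sum.map₁ (λ (z∈q , z≢x) → x∈p∧x≢y⇒x∈p-y z∈q z≢x) ∘ p⊆) ⟩
  suc ∣ q - x ∣  ≡⟨ x∈p⇒∣p∣≡1+∣p-x∣ x∈q ⟨
  ∣ q ∣          ∎
  where open ≤-Reasoning

length≤∣p∣ : ∀ {n} {p : Subset n} (xs : List (Fin n)) → Unique xs → All (_∈ p) xs → length xs ≤ ∣ p ∣
length≤∣p∣ [] _ _ = z≤n
length≤∣p∣ {p = p} (x ∷ xs) (x∉xs ∷ xs!) (x∈p ∷ xs⊆p) = begin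
  suc (length xs)  ≤⟨ s≤s (length≤∣p∣ xs xs! (All.zipWith ∈p-x (xs⊆p , x∉xs))) ⟩
  suc ∣ p - x ∣    ≡⟨ x∈p⇒∣p∣≡1+∣p-x∣ x∈p ⟨
  ∣ p ∣            ∎
  where
  open ≤-Reasoning
  ∈p-x : ∀ {y} → y ∈ p × x ≢ y → y ∈ p - x
  ∈p-x (y∈p , x≢y) = x∈p∧x≢y⇒x∈p-y y∈p (x≢y ∘ sym)

module _ {m : ℕ} {A : Fin m → Fin m → Set} where

  private variable
    P Q : Fin m → Set
    u v w : Fin m

  walk-start : WalkIn A P u v → P u
  walk-start (here p)     = p
  walk-start (step p _ _) = p

  walk-end : WalkIn A P u v → P v
  walk-end (here p)     = p
  walk-end (step _ _ r) = walk-end r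

  infixr 5 _++ʷ_
  _++ʷ_ : WalkIn A P u v → WalkIn A P v w → WalkIn A P u w
  here _     ++ʷ q = q
  step p e r ++ʷ q = step p e (r ++ʷ q)

  weaken : (∀ {z} → P z → Q z) → WalkIn A P u v → WalkIn A Q u v
  weaken f (here p)     = here (f p)
  weaken f (step p e r) = step (f p) e (weaken f r)

  NonTrivial : WalkIn A P u v → Set
  NonTrivial (here _)     = ⊥
  NonTrivial (step _ _ _) = ⊤

  second : WalkIn A P u v → Fin m
  second (here {u} _)         = u
  second (step {w = w} _ _ _) = w

  penultimate : WalkIn A P u v → Fin m
  penultimate (here {u} _)              = u
  penultimate (step {u} _ _ (here _))   = u
  penultimate (step _ _ r@(step _ _ _)) = penultimate r

  second-P : (r : WalkIn A P u v) → P (second r)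
  second-P (here p)     = p
  second-P (step _ _ r) = walk-start r

  penultimate-P : (r : WalkIn A P u v) → P (penultimate r)
  penultimate-P (here p)                  = p
  penultimate-P (step p _ (here _))       = p
  penultimate-P (step _ _ r@(step _ _ _)) = penultimate-P r

  NonBacktracking : WalkIn A P u v → Set
  NonBacktracking (here _)         = ⊤
  NonBacktracking (step {u} _ _ r) = NonBacktracking r × (NonTrivial r → u ≢ second r)

  ++-nonBacktracking : (p : WalkIn A P u v) (q : WalkIn A P v w) →
                       NonBacktracking p → NonBacktracking q →
                       (NonTrivial p → NonTrivial q → penultimate p ≢ second q) →
                       NonBacktracking (p ++ʷ q)
  ++-nonBacktracking (here _)                  q            _          nb-q _  = nb-q
  ++-nonBacktracking (step _ _ (here _))       (here _)     _          nb-q _  = nb-q , λ ()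
  ++-nonBacktracking (step _ _ (here _))       (step _ _ _) _          nb-q jn = nb-q , λ _ → jn tt tt
  ++-nonBacktracking (step _ _ r@(step _ _ _)) q            (nb-r , d) nb-q jn =
    ++-nonBacktracking r q nb-r nb-q jn , d

  ++-nonTrivial : (p : WalkIn A P u v) (q : WalkIn A P v w) → NonTrivial p → NonTrivial (p ++ʷ q)
  ++-nonTrivial (step _ _ _) q _ = tt

  second-++ : (p : WalkIn A P u v) (q : WalkIn A P v w) → NonTrivial p → second (p ++ʷ q) ≡ second p
  second-++ (step _ _ _) q _ = refl

  penultimate-snoc : (p : WalkIn A P u v) {pv : P v} {e : A v w} {pw : P w} →
                     penultimate (p ++ʷ step pv e (here pw)) ≡ v
  penultimate-snoc (here _)                  = refl
  penultimate-snoc (step _ _ (here _))       = refl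
  penultimate-snoc (step _ _ r@(step _ _ _)) = penultimate-snoc r

  snoc-nonTrivial : (p : WalkIn A P u v) {pv : P v} {e : A v w} {pw : P w} →
                    NonTrivial (p ++ʷ step pv e (here pw))
  snoc-nonTrivial (here _)     = tt
  snoc-nonTrivial (step _ _ _) = tt

  module _ (f : ∀ {z} → P z → Q z) where

    weaken-nonTrivial : (r : WalkIn A P u v) → NonTrivial r → NonTrivial (weaken f r)
    weaken-nonTrivial (step _ _ _) _ = tt

    weaken-nonBacktracking : (r : WalkIn A P u v) → NonBacktracking r → NonBacktracking (weaken f r)
    weaken-nonBacktracking (here _)                  _        = tt
    weaken-nonBacktracking (step _ _ (here _))       _        = tt , λ ()
    weaken-nonBacktracking (step _ _ r@(step _ _ _)) (nb , d) = weaken-nonBacktracking r nb , λ _ → d tt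

    second-weaken : (r : WalkIn A P u v) → second (weaken f r) ≡ second r
    second-weaken (here _)     = refl
    second-weaken (step _ _ _) = refl

    penultimate-weaken : (r : WalkIn A P u v) → penultimate (weaken f r) ≡ penultimate r
    penultimate-weaken (here _)                  = refl
    penultimate-weaken (step _ _ (here _))       = refl
    penultimate-weaken (step _ _ r@(step _ _ _)) = penultimate-weaken r

  module _ (A-sym : ∀ {u v} → A u v → A v u) where

    reverse : WalkIn A P u v → WalkIn A P v u
    reverse (here p)     = here p
    reverse (step p e r) = reverse r ++ʷ step (walk-start r) (A-sym e) (here p)

    penultimate-reverse : (r : WalkIn A P u v) → penultimate (reverse r) ≡ second r
    penultimate-reverse (here _)     = refl
    penultimate-reverse (step _ _ r) = penultimate-snoc (reverse r)

    reverse-nonTrivial : (r : WalkIn A P u v) → NonTrivial r → NonTrivial (reverse r)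
    reverse-nonTrivial (step _ _ r) _ = snoc-nonTrivial (reverse r)

    reverse-nonBacktracking : (r : WalkIn A P u v) → NonBacktracking r → NonBacktracking (reverse r)
    reverse-nonBacktracking (here _)                  _        = tt
    reverse-nonBacktracking (step _ _ (here _))       _        = tt , λ ()
    reverse-nonBacktracking (step p e r@(step _ _ _)) (nb , d) =
      ++-nonBacktracking (reverse r) (step (walk-start r) (A-sym e) (here p))
        (reverse-nonBacktracking r nb) (tt , λ ())
        (λ _ _ eq → d tt (sym (trans (sym (penultimate-reverse r)) eq)))

mapEdges : ∀ {m} {A B : Fin m → Fin m → Set} {P : Fin m → Set} →
           (∀ {u v} → P u → P v → A u v → B u v) → ∀ {x y} → WalkIn A P x y → WalkIn B P x y
mapEdges f (here p)     = here p
mapEdges f (step p e r) = step p (f p (walk-start r) e) (mapEdges f r)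

-- Walks in trees

module _ {m : ℕ} {A : Fin m → Fin m → Set} where

  linked-prefix : ∀ {x} xs {ys} → Linked A (x ∷ xs ++ ys) → Linked A (x ∷ xs)
  linked-prefix []       _        = [-]
  linked-prefix (_ ∷ xs) (e ∷ lk) = e ∷ linked-prefix xs lk

  linked-lastOf : ∀ x xs {y ys} → Linked A (x ∷ xs ++ y ∷ ys) → A (lastOf x xs) y
  linked-lastOf x []       (e ∷ _)  = e
  linked-lastOf x (z ∷ xs) (_ ∷ lk) = linked-lastOf z xs lk

unique-prefix : ∀ {X : Set} (xs : List X) {ys} → Unique (xs ++ ys) → Unique xs
unique-prefix []       _          = []
unique-prefix (_ ∷ xs) (x∉ ∷ xs!) = AllP.++⁻ˡ xs x∉ ∷ unique-prefix xs xs!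

unique-∉-prefix : ∀ {X : Set} (xs : List X) {y ys} → Unique (xs ++ y ∷ ys) → All (y ≢_) xs
unique-∉-prefix []       _          = []
unique-∉-prefix (_ ∷ xs) (x∉ ∷ xs!) = (All.head (AllP.++⁻ʳ xs x∉) ∘ sym) ∷ unique-∉-prefix xs xs!

module _ {m : ℕ} {A : Fin m → Fin m → Set} {P : Fin m → Set}
         (A-irr : ∀ {u} → A u u → ⊥) (acyclic : ¬ HasCycle A) where

  private variable
    u v w : Fin m

  toList : WalkIn A P u v → List (Fin m)
  toList (here {u} _)     = u ∷ []
  toList (step {u} _ _ r) = u ∷ toList r

  linked-∷-toList : A u w → (r : WalkIn A P w v) → Linked A (u ∷ toList r)
  linked-∷-toList e (here _)       = e ∷ [-]
  linked-∷-toList e (step _ e′ r) = e ∷ linked-∷-toList e′ r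

  ∈-toList-end : (r : WalkIn A P u v) → v ∈ₗ toList r
  ∈-toList-end (here _)     = here refl
  ∈-toList-end (step _ _ r) = there (∈-toList-end r)

  -- a first return of u to the walk u → w → … closes a cycle of length at least 3
  no-return : (e : A u w) (r : WalkIn A P w v) → (NonTrivial r → u ≢ second r) →
              Unique (toList r) → ∀ pre {post} → toList r ≡ pre ++ u ∷ post → ⊥
  no-return e (here _)     _ _ [] refl = A-irr e
  no-return e (step _ _ _) _ _ [] refl = A-irr e
  no-return e (step _ _ (here _))     d _ (_ ∷ []) refl = d tt refl
  no-return e (step _ _ (step _ _ _)) d _ (_ ∷ []) refl = d tt refl
  no-return {u} e r _ r! pre@(_ ∷ _ ∷ _) eq =
    acyclic (u , pre , s≤s (s≤s (s≤s z≤n)) , unique-∉-prefix pre r!′ ∷ unique-prefix pre r!′ ,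
             linked-prefix pre lk , linked-lastOf u pre lk)
    where
    r!′ = subst Unique eq r!
    lk  = subst (λ xs → Linked A (u ∷ xs)) eq (linked-∷-toList e r)

  nonBacktracking⇒unique : (r : WalkIn A P u v) → NonBacktracking r → Unique (toList r)
  nonBacktracking⇒unique (here _)         _        = [] ∷ []
  nonBacktracking⇒unique (step {u} _ e r) (nb , d) = All.tabulate u∉r ∷ r!
    where
    r! = nonBacktracking⇒unique r nb
    u∉r : ∀ {x} → x ∈ₗ toList r → u ≢ x
    u∉r x∈r refl with pre , post , eq ← ∈-∃++ x∈r = no-return e r d r! pre eq

  closed-nonBacktracking⇒trivial : (r : WalkIn A P u u) → NonBacktracking r → NonTrivial r → ⊥
  closed-nonBacktracking⇒trivial r@(step _ _ r′) nb _ with u∉r′ ∷ _ ← nonBacktracking⇒unique r nb =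
    All.lookup u∉r′ (∈-toList-end r′) refl

module TreeWalks (T : Tree) where
  open Tree T

  private variable
    P B C : Fin m → Set
    u v w x y s : Fin m

  Anywhere : Fin m → Set
  Anywhere _ = ⊤

  forget : WalkIn Adj P u v → WalkIn Adj Anywhere u v
  forget = weaken (λ _ → tt)

  prune : (r : WalkIn Adj P u v) → Σ (WalkIn Adj P u v) NonBacktracking
  prune (here p) = here p , tt
  prune (step {u} p e r) with prune r
  ... | here q , _ = step p e (here q) , tt , λ ()
  ... | r′@(step {w = s} _ _ r″) , (nb″ , d) with u ≟ s
  ...   | yes refl = r″ , nb″
  ...   | no u≢s   = step p e r′ , (nb″ , d) , λ _ → u≢s

  drop-common-prefix : (b : WalkIn Adj B y w) (c : WalkIn Adj C y v) →
                       NonBacktracking b → NonBacktracking c →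
                       Σ (Fin m) λ j → Σ (WalkIn Adj B j w) λ b′ → Σ (WalkIn Adj C j v) λ c′ →
                       NonBacktracking b′ × NonBacktracking c′ ×
                       (NonTrivial b′ → NonTrivial c′ → second b′ ≢ second c′)
  drop-common-prefix b@(here _)     c            nb nc = _ , b , c , nb , nc , λ ()
  drop-common-prefix b@(step _ _ _) c@(here _)   nb nc = _ , b , c , nb , nc , λ _ ()
  drop-common-prefix b@(step {w = s₁} _ _ b₁) c@(step {w = s₂} _ _ c₁) nb nc with s₁ ≟ s₂
  ... | yes refl = drop-common-prefix b₁ c₁ (proj₁ nb) (proj₁ nc)
  ... | no s₁≢s₂ = _ , b , c , nb , nc , λ _ _ → s₁≢s₂

  closed-join-backtracks : (σ : WalkIn Adj Anywhere w v) (ρ : WalkIn Adj Anywhere v w) →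
                           NonBacktracking σ → NonBacktracking ρ → NonTrivial σ →
                           penultimate σ ≢ second ρ → ⊥
  closed-join-backtracks σ ρ nσ nρ tσ jn =
    closed-nonBacktracking⇒trivial Adj-irr acyclic (σ ++ʷ ρ)
      (++-nonBacktracking σ ρ nσ nρ (λ _ _ → jn)) (++-nonTrivial σ ρ tσ)

  detour : ∀ {Out w v s u} → ¬ Out w → ¬ Out v → w ≢ v →
           Adj w s → (μ : WalkIn Adj Out s u) → NonBacktracking μ → Adj u v →
           Σ (WalkIn Adj Anywhere w v) λ σ → NonBacktracking σ × NonTrivial σ × Out (penultimate σ)
  detour {Out} {w} {v} {s} {u} ¬w ¬v w≢v e₁ μ nμ e₂ =
    σ , ++-nonBacktracking (step tt e₁ (forget μ)) (step tt e₂ (here tt))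
          (nμ′ , w≢second μ) (tt , λ ()) (λ _ _ → junction μ)
      , snoc-nonTrivial (step tt e₁ (forget μ)) {e = e₂}
      , subst Out (sym (penultimate-snoc (step tt e₁ (forget μ)))) (walk-end μ)
    where
    σ = step tt e₁ (forget μ) ++ʷ step tt e₂ (here tt)
    nμ′ = weaken-nonBacktracking (λ _ → tt) μ nμ
    w≢second : ∀ {s} (μ : WalkIn Adj Out s u) → NonTrivial (forget μ) → w ≢ second (forget μ)
    w≢second (step _ _ r) _ refl = ¬w (walk-start r)
    junction : (μ : WalkIn Adj Out s u) → penultimate (step tt e₁ (forget μ)) ≢ v
    junction (here _) = w≢v
    junction μ@(step _ _ _) eq = ¬v (subst Out (trans (sym (penultimate-weaken (λ _ → tt) μ)) eq) (penultimate-P μ))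

  no-reentry : ∀ {B x t s u} → B x → B t → x ≢ t → Adj x s → WalkIn Adj (¬_ ∘ B) u s → Adj u t →
               WalkIn Adj B t x → ⊥
  no-reentry {B} bx bt x≢t e₁ μ e₂ ρ₀
    with μ′ , nμ′ ← prune (reverse Adj-sym μ)
    with σ , nσ , tσ , out ← detour (λ ¬bx → ¬bx bx) (λ ¬bt → ¬bt bt) x≢t e₁ μ′ nμ′ e₂
    with prune ρ₀
  ... | here _ , _ = x≢t refl
  ... | ρ@(step _ _ _) , nρ =
    closed-join-backtracks σ (forget ρ) nσ (weaken-nonBacktracking (λ _ → tt) ρ nρ) tσ
      (λ eq → out (subst B (trans (sym (second-weaken (λ _ → tt) ρ)) (sym eq)) (second-P ρ)))

  Link : (B C : Fin m → Set) → Fin m → Fin m → Set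
  Link B C w v = Adj w v ⊎ Σ (Fin m) λ s → Σ (Fin m) λ u →
                 Adj w s × WalkIn Adj (λ z → ¬ B z × ¬ C z) u s × Adj u v

  link-walk : ∀ {B C w v} → B w → ¬ C w → C v → Link B C w v →
              Σ (WalkIn Adj Anywhere w v) λ σ → NonBacktracking σ × NonTrivial σ × ¬ C (penultimate σ)
  link-walk bw ¬cw cv (inj₁ e) = step tt e (here tt) , (tt , λ ()) , tt , ¬cw
  link-walk {C = C} bw ¬cw cv (inj₂ (s , u , e₁ , μ , e₂))
    with μ′ , nμ′ ← prune (reverse Adj-sym μ)
    with σ , nσ , tσ , out ← detour (λ out → proj₁ out bw) (λ out → proj₂ out cv)
                                   (λ { refl → ¬cw cv }) e₁ μ′ nμ′ e₂
    = σ , nσ , tσ , proj₂ out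

  no-link : ∀ {B C w v y} → B w → ¬ C w → C v → ¬ B v →
            WalkIn Adj B y w → WalkIn Adj C y v → Link B C w v → ⊥
  no-link {B} {C} bw ¬cw cv ¬bv β₀ γ₀ link
    with β , nβ ← prune β₀
    with γ , nγ ← prune γ₀
    with drop-common-prefix β γ nβ nγ
  ... | _ , here _ , γ′ , _ = ¬cw (walk-start γ′)
  ... | _ , β′@(step _ _ _) , here _ , _ = ¬bv (walk-start β′)
  ... | _ , β′@(step _ _ _) , γ′@(step _ _ _) , nβ′ , nγ′ , fork
    with σ , nσ , tσ , out ← link-walk bw ¬cw cv link
    = closed-join-backtracks σ ρ nσ nρ tσ
        (λ eq → out (subst C (trans (sym second-ρ) (sym eq)) (second-P γ⁻)))
    where
    γ⁻ = reverse Adj-sym γ′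
    ρ = forget γ⁻ ++ʷ forget β′
    second-ρ : second ρ ≡ second γ⁻
    second-ρ = trans (second-++ (forget γ⁻) (forget β′)
                        (weaken-nonTrivial (λ _ → tt) γ⁻ (reverse-nonTrivial Adj-sym γ′ tt)))
                     (second-weaken (λ _ → tt) γ⁻)
    nρ : NonBacktracking ρ
    nρ = ++-nonBacktracking (forget γ⁻) (forget β′)
           (weaken-nonBacktracking (λ _ → tt) γ⁻ (reverse-nonBacktracking Adj-sym γ′ nγ′))
           (weaken-nonBacktracking (λ _ → tt) β′ nβ′)
           (λ _ _ eq → fork tt tt (begin
              second β′                ≡⟨ second-weaken (λ _ → tt) β′ ⟨
              second (forget β′)       ≡⟨ eq ⟨
              penultimate (forget γ⁻)  ≡⟨ penultimate-weaken (λ _ → tt) γ⁻ ⟩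
              penultimate γ⁻           ≡⟨ penultimate-reverse Adj-sym γ′ ⟩
              second γ′                ∎))
      where open ≡-Reasoning

  module Subtree {B : Fin m → Set} (B? : Decidable B) (B-connected : ∀ {a b} → B a → B b → WalkIn Adj B a b) where

    mutual
      restrict : B u → WalkIn Adj P u y → B y → WalkIn Adj (λ z → P z × B z) u y
      restrict bu (here p) _ = here (p , bu)
      restrict bu (step {w = s} p e r) by with B? s
      ... | yes bs = step (p , bu) e (restrict bs r by)
      ... | no ¬bs = restrict-outside bu e (here ¬bs) r by

      -- μ records, in reverse, the excursion outside B that began with the step x → s
      restrict-outside : B x → Adj x s → WalkIn Adj (¬_ ∘ B) u s → WalkIn Adj P u y → B y →
                         WalkIn Adj (λ z → P z × B z) x y
      restrict-outside bx e₀ μ (here _) by = ⊥-elim (walk-start μ by)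
      restrict-outside {x} bx e₀ μ (step {w = t} p e r) by with B? t
      ... | no ¬bt = restrict-outside bx e₀ (step ¬bt (Adj-sym e) μ) r by
      ... | yes bt with x ≟ t
      ...   | yes refl = restrict bt r by
      ...   | no x≢t  = ⊥-elim (no-reentry bx bt x≢t e₀ μ e (B-connected bt bx))

  module Helly {B C : Fin m → Set} (B? : Decidable B) (C? : Decidable C)
               (B-connected : ∀ {a b} → B a → B b → WalkIn Adj B a b)
               (C-connected : ∀ {a b} → C a → C b → WalkIn Adj C a b)
               (by : B y) (cy : C y) where

    mutual
      meet : B u → WalkIn Adj P u v → C v → Σ (Fin m) λ q → P q × B q × C q
      meet {u} bu r cv with C? u
      ... | yes cu = u , walk-start r , bu , cu
      meet bu (here _) cv | no ¬cu = ⊥-elim (¬cu cv)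
      meet bu (step {w = s} p e r) cv | no ¬cu with B? s
      ... | yes bs = meet bs r cv
      ... | no ¬bs with C? s
      ...   | yes cs  = ⊥-elim (no-link bu ¬cu cs ¬bs (B-connected by bu) (C-connected cy cs) (inj₁ e))
      ...   | no ¬cs = meet-outside bu ¬cu e (here (¬bs , ¬cs)) r cv

      meet-outside : B w → ¬ C w → Adj w s → WalkIn Adj (λ z → ¬ B z × ¬ C z) u s →
                     WalkIn Adj P u v → C v → Σ (Fin m) λ q → P q × B q × C q
      meet-outside bw ¬cw e₀ μ (here _) cv = ⊥-elim (proj₂ (walk-start μ) cv)
      meet-outside bw ¬cw e₀ μ (step {w = t} p e r) cv with B? t
      ... | yes bt = meet bt r cv
      ... | no ¬bt with C? t
      ...   | yes ct  = ⊥-elim (no-link bw ¬cw ct ¬bt (B-connected by bw) (C-connected cy ct)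
                                         (inj₂ (_ , _ , e₀ , μ , e)))
      ...   | no ¬ct = meet-outside bw ¬cw e₀ (step (¬bt , ¬ct) (Adj-sym e) μ) r cv

-- Tree decompositions

module _ {n : ℕ} {Γ : Graph n} (D : TreeDecomposition Γ) where
  open TreeDecomposition D
  open Tree T using (m; Adj)
  open TreeWalks T

  private variable
    Q : Fin n → Set
    q q′ : Fin n
    i j : Fin m

  Meets : (Fin n → Set) → Fin m → Set
  Meets Q i = Σ (Fin n) λ q → Q q × q ∈ bag i

  in-bag? : ∀ x → Decidable (λ i → x ∈ bag i)
  in-bag? x i = x ∈? bag i

  meets? : Decidable Q → Decidable (Meets Q)
  meets? Q? i = any? (λ q → Q? q ×-dec (q ∈? bag i))

  walk⇒meets-walk : WalkIn (E Γ) Q q q′ → q ∈ bag i → q′ ∈ bag j → WalkIn Adj (Meets Q) i j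
  walk⇒meets-walk {q = q} (here Qq) q∈i q∈j = weaken (λ q∈ → q , Qq , q∈) (coherent q q∈i q∈j)
  walk⇒meets-walk {q = q} (step Qq e r) q∈i q′∈j with k , q∈k , r∈k ← cover-E e =
    weaken (λ q∈ → q , Qq , q∈) (coherent q q∈i q∈k) ++ʷ walk⇒meets-walk r r∈k q′∈j

  meets-connected : (∀ {q q′} → Q q → Q q′ → WalkIn (E Γ) Q q q′) → Meets Q i → Meets Q j →
                    WalkIn Adj (Meets Q) i j
  meets-connected Q-connected (_ , Qq , q∈i) (_ , Qq′ , q′∈j) = walk⇒meets-walk (Q-connected Qq Qq′) q∈i q′∈j

  no-four-in-bag : width≤ 2 → ∀ {a b c d i} → a ≢ b → a ≢ c → a ≢ d → b ≢ c → b ≢ d → c ≢ d →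
                   a ∈ bag i → b ∈ bag i → c ∈ bag i → d ∈ bag i → ⊥
  no-four-in-bag width {a} {b} {c} {d} {i} a≢b a≢c a≢d b≢c b≢d c≢d a∈ b∈ c∈ d∈
    with s≤s (s≤s (s≤s ())) ← ≤-trans (length≤∣p∣ (a ∷ b ∷ c ∷ d ∷ [])
           ((a≢b ∷ a≢c ∷ a≢d ∷ []) ∷ (b≢c ∷ b≢d ∷ []) ∷ (c≢d ∷ []) ∷ [] ∷ []) (a∈ ∷ b∈ ∷ c∈ ∷ d∈ ∷ [])) (width i)

  -- a triangle abc and a connected set Q adjacent to a, b and c form a K₄ model; three uses of the
  -- Helly property for subtrees yield a bag containing a, b, c and a vertex of Q
  no-K₄-model : width≤ 2 → Decidable Q → (∀ {q q′} → Q q → Q q′ → WalkIn (E Γ) Q q q′) →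
                ∀ {a b c} → a ≢ b → a ≢ c → b ≢ c → ¬ Q a → ¬ Q b → ¬ Q c →
                E Γ a b → E Γ a c → E Γ b c →
                (∃ λ q → Q q × E Γ a q) → (∃ λ q → Q q × E Γ b q) → (∃ λ q → Q q × E Γ c q) → ⊥
  no-K₄-model width Q? Q-connected {a} {b} {c} a≢b a≢c b≢c ¬Qa ¬Qb ¬Qc ab ac bc
              (qa , Qqa , a-qa) (qb , Qqb , b-qb) (qc , Qqc , c-qc)
    with _ , a∈ab , b∈ab ← cover-E ab
    with _ , a∈ac , c∈ac ← cover-E ac
    with _ , b∈bc , c∈bc ← cover-E bc
    with _ , a∈aq , qa∈aq ← cover-E a-qa
    with _ , b∈bq , qb∈bq ← cover-E b-qb
    with _ , c∈cq , qc∈cq ← cover-E c-qc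
    with q₁ , a∈q₁ , b∈q₁ , c∈q₁ ←
           Helly.meet (in-bag? b) (in-bag? c) (coherent b) (coherent c) b∈bc c∈bc
             b∈ab (coherent a a∈ab a∈ac) c∈ac
    with q₂ , a∈q₂ , b∈q₂ , Q∩q₂ ←
           Helly.meet (in-bag? b) (meets? Q?) (coherent b) (meets-connected Q-connected)
             b∈bq (qb , Qqb , qb∈bq) b∈ab (coherent a a∈ab a∈aq) (qa , Qqa , qa∈aq)
    with q , (a∈q , b∈q) , c∈q , h , Qh , h∈q ←
           Helly.meet (in-bag? c) (meets? Q?) (coherent c) (meets-connected Q-connected)
             c∈cq (qc , Qqc , qc∈cq)
             c∈q₁ (Subtree.restrict (in-bag? b) (coherent b) b∈q₁ (coherent a a∈q₁ a∈q₂) b∈q₂) Q∩q₂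
    = no-four-in-bag width a≢b a≢c (λ { refl → ¬Qa Qh }) b≢c (λ { refl → ¬Qb Qh }) (λ { refl → ¬Qc Qh })
        a∈q b∈q c∈q h∈q

TW≤-restrict : ∀ {n k} {Γ Γ′ : Graph n} {K : Fin n → Set} → Decidable K →
               (∀ {x} → V Γ′ x → V Γ x × K x) → (∀ {x} → V Γ x → K x → V Γ′ x) →
               (∀ {u v} → E Γ′ u v → E Γ u v) → TW≤ Γ k → TW≤ Γ′ k
TW≤-restrict {Γ′ = Γ′} {K} K? V⇒ ⇒V E⇒ (D , width) = D′ , λ i → ≤-trans (p⊆q⇒∣p∣≤∣q∣ (proj₁ ∘ ∈-bag′⁻ i)) (width i)
  where
  open TreeDecomposition D
  bag′ : _ → Subset _
  bag′ i = subset (λ x → (x ∈? bag i) ×-dec K? x)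
  ∈-bag′⁻ : ∀ i {x} → x ∈ bag′ i → x ∈ bag i × K x
  ∈-bag′⁻ i = ∈-subset⁻ (λ x → (x ∈? bag i) ×-dec K? x)
  ∈-bag′⁺ : ∀ {i x} → x ∈ bag i → K x → x ∈ bag′ i
  ∈-bag′⁺ {i} x∈ Kx = ∈-subset⁺ (λ x → (x ∈? bag i) ×-dec K? x) (x∈ , Kx)
  D′ : TreeDecomposition Γ′
  D′ = record
    { T        = T
    ; bag      = bag′
    ; bag-V    = λ i x∈ → let x∈i , Kx = ∈-bag′⁻ i x∈ in ⇒V (bag-V i x∈i) Kx
    ; cover-V  = λ vx → let i , x∈i = cover-V (proj₁ (V⇒ vx)) in i , ∈-bag′⁺ x∈i (proj₂ (V⇒ vx))
    ; cover-E  = λ e → let i , u∈i , v∈i = cover-E (E⇒ e)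
                       in i , ∈-bag′⁺ u∈i (proj₂ (V⇒ (E-V Γ′ e))) , ∈-bag′⁺ v∈i (proj₂ (V⇒ (E-V Γ′ (E-sym Γ′ e))))
    ; coherent = λ x {i} {j} xi xj →
        weaken (λ x∈ → ∈-bag′⁺ x∈ (proj₂ (∈-bag′⁻ i xi))) (coherent x (proj₁ (∈-bag′⁻ i xi)) (proj₁ (∈-bag′⁻ j xj)))
    }

-- Joining trees and tree decompositions

lastOf′ : ∀ {X : Set} → X → List X → X
lastOf′ x []       = x
lastOf′ x (y ∷ ys) = lastOf′ y ys

lastOf′-map : ∀ {k} {X : Set} (f : Fin k → X) x xs → lastOf′ (f x) (List.map f xs) ≡ f (lastOf x xs)
lastOf′-map f x []       = refl
lastOf′-map f x (y ∷ ys) = lastOf′-map f y ys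

-- lr is the only edge between the two sides, so a cycle cannot cross: it would have to return through lr
module TwoSided {X : Set} (IsL IsR : X → Set) (R : X → X → Set) (l r : X)
                (side : ∀ s → IsL s ⊎ IsR s)
                (crossLR : ∀ {s t} → R s t → IsL s → IsR t → s ≡ l × t ≡ r)
                (crossRL : ∀ {s t} → R s t → IsR s → IsL t → s ≡ r × t ≡ l) where

  stays-right : ∀ s ts → IsR s → Linked R (s ∷ ts) → l ∉ₗ ts → All IsR ts
  stays-right s []       _  _        _   = []
  stays-right s (t ∷ ts) Rs (e ∷ lk) l∉ with side t
  ... | inj₂ Rt = Rt ∷ stays-right t ts Rt lk (l∉ ∘ there)
  ... | inj₁ Lt = ⊥-elim (l∉ (here (sym (proj₂ (crossRL e Rs Lt)))))

  first-crossing : ∀ s ss → IsL s → Unique (s ∷ ss) → Linked R (s ∷ ss) →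
                   All IsL (s ∷ ss) ⊎
                   Σ (List X) λ pre → Σ (List X) λ post → (s ∷ ss ≡ pre ++ l ∷ r ∷ post) × All IsR post
  first-crossing s []       Ls _          _        = inj₁ (Ls ∷ [])
  first-crossing s (t ∷ ts) Ls (s∉ ∷ ts!) (e ∷ lk) with side t
  ... | inj₁ Lt = Sum.map (Ls ∷_) (λ (pre , post , eq , Rpost) → s ∷ pre , post , cong (s ∷_) eq , Rpost)
                          (first-crossing t ts Lt ts! lk)
  ... | inj₂ Rt with refl , refl ← crossLR e Ls Rt =
    inj₂ ([] , ts , refl , stays-right t ts Rt lk (λ l∈ → All.lookup s∉ (there l∈) refl))

  lastOf′-∈ : ∀ (x : X) xs → lastOf′ x xs ≡ x ⊎ lastOf′ x xs ∈ₗ xs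
  lastOf′-∈ x []       = inj₁ refl
  lastOf′-∈ x (y ∷ ys) = inj₂ (Sum.[ here , there ]′ (lastOf′-∈ y ys))

  lastOf′-++ : ∀ (x : X) xs y ys → lastOf′ x (xs ++ y ∷ ys) ≡ lastOf′ y ys
  lastOf′-++ x []       y ys = refl
  lastOf′-++ x (z ∷ xs) y ys = lastOf′-++ z xs y ys

  ∈-++-∷ : ∀ (xs : List X) {y ys} → y ∈ₗ xs ++ y ∷ ys
  ∈-++-∷ []       = here refl
  ∈-++-∷ (_ ∷ xs) = there (∈-++-∷ xs)

  unique-∉-suffix : ∀ (xs : List X) {y ys} → Unique (xs ++ y ∷ ys) → y ∉ₗ ys
  unique-∉-suffix []       (y∉ ∷ _) y∈ = All.lookup y∉ y∈ refl
  unique-∉-suffix (_ ∷ xs) (_ ∷ u)     = unique-∉-suffix xs u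

  module _ (Rr : IsR r) where

    return-to-l : ∀ post {c} → All IsR post → R (lastOf′ r post) c → IsL c → r ∉ₗ post → post ≡ [] × c ≡ l
    return-to-l [] _ e Lc _ = refl , proj₂ (crossRL e Rr Lc)
    return-to-l (s ∷ post) Rpost e Lc r∉ with lastOf′-∈ s post
    ... | inj₁ eq = ⊥-elim (r∉ (here (trans (sym (proj₁ (crossRL e (subst IsR (sym eq) (All.head Rpost)) Lc))) eq)))
    ... | inj₂ k  = ⊥-elim (r∉ (there (subst (_∈ₗ post) (proj₁ (crossRL e (All.lookup Rpost (there k)) Lc)) k)))

    no-crossing-cycle : ∀ c cs pre post → 3 ≤ length (c ∷ cs) → IsL c → Unique (c ∷ cs) →
                        R (lastOf′ c cs) c → c ∷ cs ≡ pre ++ l ∷ r ∷ post → All IsR post → ⊥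
    no-crossing-cycle c cs [] post len Lc u e refl Rpost
      with return-to-l post Rpost e Lc (unique-∉-suffix (l ∷ []) u) | len
    ... | refl , _ | s≤s (s≤s ())
    no-crossing-cycle c cs (a ∷ pre) post len Lc u e refl Rpost
      with _ , refl ← return-to-l post Rpost (subst (λ z → R z c) (lastOf′-++ a pre l (r ∷ post)) e) Lc
                                  (unique-∉-suffix (a ∷ pre ++ l ∷ [])
                                     (subst Unique (sym (List.++-assoc (a ∷ pre) _ _)) u))
      = All.lookup (AllPairs.head u) (∈-++-∷ pre) refl

    cycle-stays-left : ∀ c cs → 3 ≤ length (c ∷ cs) → IsL c → Unique (c ∷ cs) → Linked R (c ∷ cs) →
                       R (lastOf′ c cs) c → All IsL (c ∷ cs)
    cycle-stays-left c cs len Lc u lk e with first-crossing c cs Lc u lk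
    ... | inj₁ L-all = L-all
    ... | inj₂ (pre , post , eq , Rpost) = ⊥-elim (no-crossing-cycle c cs pre post len Lc u e eq Rpost)

module JoinTrees (T₁ T₂ : Tree) (p₁ : Fin (Tree.m T₁)) (p₂ : Fin (Tree.m T₂)) where
  private
    module T₁ = Tree T₁
    module T₂ = Tree T₂

  m₁ = T₁.m
  m₂ = T₂.m

  Node = Fin m₁ ⊎ Fin m₂

  AdjN : Node → Node → Set
  AdjN (inj₁ a) (inj₁ b) = T₁.Adj a b
  AdjN (inj₂ a) (inj₂ b) = T₂.Adj a b
  AdjN (inj₁ a) (inj₂ b) = a ≡ p₁ × b ≡ p₂
  AdjN (inj₂ a) (inj₁ b) = a ≡ p₂ × b ≡ p₁

  split : Fin (m₁ + m₂) → Node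
  split = splitAt m₁

  embed : Node → Fin (m₁ + m₂)
  embed = join m₁ m₂

  Adj : Fin (m₁ + m₂) → Fin (m₁ + m₂) → Set
  Adj i j = AdjN (split i) (split j)

  Adj-sym : ∀ {i j} → Adj i j → Adj j i
  Adj-sym {i} {j} with split i | split j
  ... | inj₁ _ | inj₁ _ = T₁.Adj-sym
  ... | inj₂ _ | inj₂ _ = T₂.Adj-sym
  ... | inj₁ _ | inj₂ _ = Product.swap
  ... | inj₂ _ | inj₁ _ = Product.swap

  Adj-irr : ∀ {i} → Adj i i → ⊥
  Adj-irr {i} with split i
  ... | inj₁ _ = T₁.Adj-irr
  ... | inj₂ _ = T₂.Adj-irr

  embed-Adj : ∀ {s t} → AdjN s t → Adj (embed s) (embed t)
  embed-Adj {s} {t} = subst₂ AdjN (sym (splitAt-join m₁ m₂ s)) (sym (splitAt-join m₁ m₂ t))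

  embed-walk₁ : ∀ {Q P} → (∀ {a} → P a → Q (embed (inj₁ a))) →
                ∀ {a b} → WalkIn T₁.Adj P a b → WalkIn Adj Q (embed (inj₁ a)) (embed (inj₁ b))
  embed-walk₁ f (here p)              = here (f p)
  embed-walk₁ f (step {a} {w} p e r)  = step (f p) (embed-Adj {inj₁ a} {inj₁ w} e) (embed-walk₁ f r)

  embed-walk₂ : ∀ {Q P} → (∀ {a} → P a → Q (embed (inj₂ a))) →
                ∀ {a b} → WalkIn T₂.Adj P a b → WalkIn Adj Q (embed (inj₂ a)) (embed (inj₂ b))
  embed-walk₂ f (here p)              = here (f p)
  embed-walk₂ f (step {a} {w} p e r)  = step (f p) (embed-Adj {inj₂ a} {inj₂ w} e) (embed-walk₂ f r)

  cross₁₂ : ∀ {Q a b} → WalkIn Adj Q a (embed (inj₁ p₁)) → WalkIn Adj Q (embed (inj₂ p₂)) b → WalkIn Adj Q a b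
  cross₁₂ r₁ r₂ = r₁ ++ʷ step (walk-end r₁) (embed-Adj {inj₁ p₁} {inj₂ p₂} (refl , refl)) r₂

  cross₂₁ : ∀ {Q a b} → WalkIn Adj Q a (embed (inj₂ p₂)) → WalkIn Adj Q (embed (inj₁ p₁)) b → WalkIn Adj Q a b
  cross₂₁ r₁ r₂ = r₁ ++ʷ step (walk-end r₁) (embed-Adj {inj₂ p₂} {inj₁ p₁} (refl , refl)) r₂

  embed-split : ∀ i → embed (split i) ≡ i
  embed-split = join-splitAt m₁ m₂

  connected : ∀ i j → WalkIn Adj (λ _ → Fin (m₁ + m₂)) i j
  connected i j = subst₂ (WalkIn Adj _) (embed-split i) (embed-split j) (connected′ (split i) (split j))
    where
    e₁ : Fin m₁ → Fin (m₁ + m₂)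
    e₁ = embed ∘ inj₁
    e₂ : Fin m₂ → Fin (m₁ + m₂)
    e₂ = embed ∘ inj₂
    connected′ : ∀ s t → WalkIn Adj (λ _ → Fin (m₁ + m₂)) (embed s) (embed t)
    connected′ (inj₁ a) (inj₁ b) = embed-walk₁ e₁ (T₁.connected a b)
    connected′ (inj₂ a) (inj₂ b) = embed-walk₂ e₂ (T₂.connected a b)
    connected′ (inj₁ a) (inj₂ b) = cross₁₂ (embed-walk₁ e₁ (T₁.connected a p₁)) (embed-walk₂ e₂ (T₂.connected p₂ b))
    connected′ (inj₂ a) (inj₁ b) = cross₂₁ (embed-walk₂ e₂ (T₂.connected a p₂)) (embed-walk₁ e₁ (T₁.connected p₁ b))

  IsL IsR : Node → Set
  IsL (inj₁ _) = ⊤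
  IsL (inj₂ _) = ⊥
  IsR (inj₁ _) = ⊥
  IsR (inj₂ _) = ⊤

  side : ∀ s → IsL s ⊎ IsR s
  side (inj₁ _) = inj₁ tt
  side (inj₂ _) = inj₂ tt

  crossLR : ∀ {s t} → AdjN s t → IsL s → IsR t → s ≡ inj₁ p₁ × t ≡ inj₂ p₂
  crossLR {inj₁ _} {inj₂ _} (refl , refl) _ _ = refl , refl

  crossRL : ∀ {s t} → AdjN s t → IsR s → IsL t → s ≡ inj₂ p₂ × t ≡ inj₁ p₁
  crossRL {inj₂ _} {inj₁ _} (refl , refl) _ _ = refl , refl

  module Left  = TwoSided IsL IsR AdjN (inj₁ p₁) (inj₂ p₂) side crossLR crossRL
  module Right = TwoSided IsR IsL AdjN (inj₂ p₂) (inj₁ p₁) (Sum.swap ∘ side) crossRL crossLR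

  all-inj₁ : ∀ cs → All IsL cs → Σ (List (Fin m₁)) λ as → List.map inj₁ as ≡ cs
  all-inj₁ []            _        = [] , refl
  all-inj₁ (inj₁ a ∷ cs) (_ ∷ Ls) = Product.map (a ∷_) (cong (inj₁ a ∷_)) (all-inj₁ cs Ls)

  all-inj₂ : ∀ cs → All IsR cs → Σ (List (Fin m₂)) λ as → List.map inj₂ as ≡ cs
  all-inj₂ []            _        = [] , refl
  all-inj₂ (inj₂ a ∷ cs) (_ ∷ Rs) = Product.map (a ∷_) (cong (inj₂ a ∷_)) (all-inj₂ cs Rs)

  IsCycle : List Node → Set
  IsCycle []       = ⊥
  IsCycle (c ∷ cs) = 3 ≤ length (c ∷ cs) × Unique (c ∷ cs) × Linked AdjN (c ∷ cs) × AdjN (lastOf′ c cs) c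

  no-cycle : ∀ cs → IsCycle cs → ⊥
  no-cycle (inj₁ a ∷ cs) (len , u , lk , e)
    with as , refl ← all-inj₁ cs (All.tail (Left.cycle-stays-left tt (inj₁ a) cs len tt u lk e)) =
    T₁.acyclic (a , as , subst (3 ≤_) (List.length-map inj₁ (a ∷ as)) len ,
                Unique.map⁻ u , Linked.map⁻ lk , subst (λ z → AdjN z (inj₁ a)) (lastOf′-map inj₁ a as) e)
  no-cycle (inj₂ a ∷ cs) (len , u , lk , e)
    with as , refl ← all-inj₂ cs (All.tail (Right.cycle-stays-left tt (inj₂ a) cs len tt u lk e)) =
    T₂.acyclic (a , as , subst (3 ≤_) (List.length-map inj₂ (a ∷ as)) len ,
                Unique.map⁻ u , Linked.map⁻ lk , subst (λ z → AdjN z (inj₂ a)) (lastOf′-map inj₂ a as) e)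

  acyclic : ¬ HasCycle Adj
  acyclic (x , xs , len , u , lk , e) =
    no-cycle (List.map split (x ∷ xs))
      ( subst (3 ≤_) (sym (List.length-map split (x ∷ xs))) len
      , Unique.map⁺ split-injective u
      , Linked.map⁺ lk
      , subst (λ z → AdjN z (split x)) (sym (lastOf′-map split x xs)) e )
    where
    split-injective : ∀ {i j} → split i ≡ split j → i ≡ j
    split-injective {i} {j} eq = trans (sym (embed-split i)) (trans (cong embed eq) (embed-split j))

  tree : Tree
  tree = record
    { m = m₁ + m₂ ; Adj = Adj ; Adj-sym = λ {i} {j} → Adj-sym {i} {j} ; Adj-irr = λ {i} → Adj-irr {i}
    ; nonempty = embed (inj₁ p₁) ; connected = connected ; acyclic = acyclic }

-- the bags at p₁ and p₂ become adjacent, so `shared` makes bags containing x connected across the two trees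
module JoinDecompositions {n : ℕ} (Γ : Graph n) (k : ℕ) (T₁ T₂ : Tree)
  (β₁ : Fin (Tree.m T₁) → Subset n) (β₂ : Fin (Tree.m T₂) → Subset n)
  (p₁ : Fin (Tree.m T₁)) (p₂ : Fin (Tree.m T₂))
  (β₁-V : ∀ a {x} → x ∈ β₁ a → V Γ x) (β₂-V : ∀ b {x} → x ∈ β₂ b → V Γ x)
  (cover-V : ∀ {x} → V Γ x → (∃ λ a → x ∈ β₁ a) ⊎ (∃ λ b → x ∈ β₂ b))
  (cover-E : ∀ {u v} → E Γ u v → (∃ λ a → u ∈ β₁ a × v ∈ β₁ a) ⊎ (∃ λ b → u ∈ β₂ b × v ∈ β₂ b))
  (coherent₁ : ∀ x {a a′} → x ∈ β₁ a → x ∈ β₁ a′ → WalkIn (Tree.Adj T₁) (λ c → x ∈ β₁ c) a a′)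
  (coherent₂ : ∀ x {b b′} → x ∈ β₂ b → x ∈ β₂ b′ → WalkIn (Tree.Adj T₂) (λ c → x ∈ β₂ c) b b′)
  (shared : ∀ {x a b} → x ∈ β₁ a → x ∈ β₂ b → x ∈ β₁ p₁ × x ∈ β₂ p₂)
  (width₁ : ∀ a → ∣ β₁ a ∣ ≤ suc k) (width₂ : ∀ b → ∣ β₂ b ∣ ≤ suc k) where

  open JoinTrees T₁ T₂ p₁ p₂

  βN : Node → Subset n
  βN = Sum.[ β₁ , β₂ ]′

  β : Fin (m₁ + m₂) → Subset n
  β i = βN (split i)

  ∈β-embed : ∀ {x} s → x ∈ βN s → x ∈ β (embed s)
  ∈β-embed {x} s = subst (λ t → x ∈ βN t) (sym (splitAt-join m₁ m₂ s))

  βN-V : ∀ s {x} → x ∈ βN s → V Γ x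
  βN-V = Sum.[ β₁-V , β₂-V ]

  coherentN : ∀ x s t → x ∈ βN s → x ∈ βN t → WalkIn Adj (λ c → x ∈ β c) (embed s) (embed t)
  coherentN x (inj₁ a) (inj₁ b) xa xb = embed-walk₁ (∈β-embed (inj₁ _)) (coherent₁ x xa xb)
  coherentN x (inj₂ a) (inj₂ b) xa xb = embed-walk₂ (∈β-embed (inj₂ _)) (coherent₂ x xa xb)
  coherentN x (inj₁ a) (inj₂ b) xa xb with xp₁ , xp₂ ← shared xa xb =
    cross₁₂ (embed-walk₁ (∈β-embed (inj₁ _)) (coherent₁ x xa xp₁))
            (embed-walk₂ (∈β-embed (inj₂ _)) (coherent₂ x xp₂ xb))
  coherentN x (inj₂ a) (inj₁ b) xa xb with xp₁ , xp₂ ← shared xb xa =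
    cross₂₁ (embed-walk₂ (∈β-embed (inj₂ _)) (coherent₂ x xa xp₂))
            (embed-walk₁ (∈β-embed (inj₁ _)) (coherent₁ x xp₁ xb))

  decomposition : TreeDecomposition Γ
  decomposition = record
    { T        = tree
    ; bag      = β
    ; bag-V    = βN-V ∘ split
    ; cover-V  = λ vx → Sum.[ (λ (a , xa) → embed (inj₁ a) , ∈β-embed (inj₁ a) xa)
                            , (λ (b , xb) → embed (inj₂ b) , ∈β-embed (inj₂ b) xb) ]′ (cover-V vx)
    ; cover-E  = λ e → Sum.[ (λ (a , ua , va) → embed (inj₁ a) , ∈β-embed (inj₁ a) ua , ∈β-embed (inj₁ a) va)
                           , (λ (b , ub , vb) → embed (inj₂ b) , ∈β-embed (inj₂ b) ub , ∈β-embed (inj₂ b) vb)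
                           ]′ (cover-E e)
    ; coherent = λ x {i} {j} xi xj →
        subst₂ (WalkIn Adj (λ c → x ∈ β c)) (embed-split i) (embed-split j) (coherentN x (split i) (split j) xi xj)
    }

  joined : TW≤ Γ k
  joined = decomposition , width ∘ split
    where
    width : ∀ s → ∣ βN s ∣ ≤ suc k
    width = Sum.[ width₁ , width₂ ]

-- Reducing H

module Reduction {n : ℕ} (G H : Graph n) (H⊆G : SubgraphOf H G) (H-connected : Connected H)
                 (Dt : TreeDecomposition (torso G H)) (Dt-width : TreeDecomposition.width≤ Dt 2) where

  private
    module Dt = TreeDecomposition Dt
    G′ = reduce G H
    N = Nbh G H

  in-torso? : ∀ x → Dec (∃ λ i → x ∈ Dt.bag i)
  in-torso? x = any? (λ i → x ∈? Dt.bag i)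

  -- V(H) and N(H) are decided by searching the (finitely many) bags of the torso
  V-H? : Decidable (V H)
  V-H? x with in-torso? x
  ... | no ∉bags = no (λ Hx → ∉bags (Dt.cover-V (inj₁ Hx)))
  ... | yes (i , x∈i) with Dt.bag-V i x∈i
  ...   | inj₁ Hx = yes Hx
  ...   | inj₂ Nx = no (proj₁ (proj₂ Nx))

  N? : Decidable N
  N? x with in-torso? x
  ... | no ∉bags = no (λ Nx → ∉bags (Dt.cover-V (inj₂ Nx)))
  ... | yes (i , x∈i) with Dt.bag-V i x∈i
  ...   | inj₁ Hx = no (λ Nx → proj₁ (proj₂ Nx) Hx)
  ...   | inj₂ Nx = yes Nx

  H-walk : ∀ {u v} → V H u → V H v → WalkIn (E G) (V H) u v
  H-walk Hu Hv = mapEdges (λ _ _ → proj₂ H⊆G) (H-connected Hu Hv)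

  at-most-two-neighbours : ∀ {a b c} → N a → N b → N c → a ≢ b → a ≢ c → b ≢ c → ⊥
  at-most-two-neighbours Na Nb Nc a≢b a≢c b≢c =
    no-K₄-model Dt Dt-width V-H? H-walk-torso a≢b a≢c b≢c (¬H Na) (¬H Nb) (¬H Nc)
      (inj₂ (Na , Nb , a≢b)) (inj₂ (Na , Nc , a≢c)) (inj₂ (Nb , Nc , b≢c))
      (attached Na) (attached Nb) (attached Nc)
    where
    H-walk-torso : ∀ {u v} → V H u → V H v → WalkIn (E (torso G H)) (V H) u v
    H-walk-torso Hu Hv = mapEdges (λ Hx Hy e → inj₁ (proj₂ H⊆G e , inj₁ Hx , inj₁ Hy)) (H-connected Hu Hv)
    ¬H : ∀ {x} → N x → ¬ V H x
    ¬H = proj₁ ∘ proj₂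
    attached : ∀ {x} → N x → ∃ λ h → V H h × E (torso G H) x h
    attached Nx@(_ , _ , h , Hh , xh) = h , Hh , inj₁ (xh , inj₂ Nx , inj₁ Hh)

  neighbours-besides : ∀ {a x y} → N a → N x → N y → x ≢ a → y ≢ a → x ≡ y
  neighbours-besides {x = x} {y} Na Nx Ny x≢a y≢a with x ≟ y
  ... | yes x≡y = x≡y
  ... | no  x≢y = ⊥-elim (at-most-two-neighbours Na Nx Ny (x≢a ∘ sym) (y≢a ∘ sym) x≢y)

  one-of-two : ∀ {a b x} → N a → N b → b ≢ a → N x → x ≡ a ⊎ x ≡ b
  one-of-two {a} {x = x} Na Nb b≢a Nx with x ≟ a
  ... | yes x≡a = inj₁ x≡a
  ... | no  x≢a = inj₂ (neighbours-besides Na Nx Nb x≢a b≢a)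

  neighbours-in-one-bag : ∀ {m} (B : Fin m → Subset n) (S : Subset n) → Fin m →
                          (∀ {x} → N x → x ∉ S → ∃ λ i → x ∈ B i) →
                          (∀ {x y} → N x → N y → x ≢ y → x ∉ S → y ∉ S → ∃ λ i → x ∈ B i × y ∈ B i) →
                          ∃ λ i → ∀ {x} → N x → x ∉ S → x ∈ B i
  neighbours-in-one-bag B S i₀ cover cover₂ with any? (λ x → N? x ×-dec ¬? (x ∈? S))
  ... | no none = i₀ , λ Nx x∉S → ⊥-elim (none (_ , Nx , x∉S))
  ... | yes (a , Na , a∉S) with any? (λ x → (N? x ×-dec ¬? (x ∈? S)) ×-dec ¬? (x ≟ a))
  ...   | no only-a with i , a∈i ← cover Na a∉S =
    i , λ {x} Nx x∉S → subst (_∈ B i) (sym (decidable-stable (x ≟ a) (λ x≢a → only-a (x , (Nx , x∉S) , x≢a)))) a∈i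
  ...   | yes (b , (Nb , b∉S) , b≢a) with i , a∈i , b∈i ← cover₂ Na Nb (b≢a ∘ sym) a∉S b∉S =
    i , λ Nx _ → Sum.[ (λ { refl → a∈i }) , (λ { refl → b∈i }) ]′ (one-of-two Na Nb b≢a Nx)

  -- glue the torso decomposition and one of G′ − S along bags holding N(H) ∖ S
  TW≤-unreduce : ∀ {S} → TW≤ (delete G′ S) 2 → TW≤ (delete G S) 2
  TW≤-unreduce {S} (D′ , D′-width) =
    JoinDecompositions.joined (delete G S) 2 Dt.T D′.T β₁ D′.bag p₁ p₂
      β₁-V (λ b x∈ → proj₁ (proj₁ (D′.bag-V b x∈)) , proj₂ (D′.bag-V b x∈))
      cover-V cover-E coherent₁ D′.coherent shared
      (λ a → ≤-trans (p⊆q⇒∣p∣≤∣q∣ (proj₁ ∘ ∈-β₁⁻)) (Dt-width a)) D′-width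
    where
    module D′ = TreeDecomposition D′
    β₁? : ∀ a → Decidable (λ x → x ∈ Dt.bag a × x ∉ S)
    β₁? a x = (x ∈? Dt.bag a) ×-dec ¬? (x ∈? S)
    β₁ : Fin (Tree.m Dt.T) → Subset n
    β₁ a = subset (β₁? a)
    ∈-β₁⁻ : ∀ {a x} → x ∈ β₁ a → x ∈ Dt.bag a × x ∉ S
    ∈-β₁⁻ {a} = ∈-subset⁻ (β₁? a)
    ∈-β₁⁺ : ∀ {a x} → x ∈ Dt.bag a → x ∉ S → x ∈ β₁ a
    ∈-β₁⁺ {a} x∈ x∉S = ∈-subset⁺ (β₁? a) (x∈ , x∉S)
    p₁-props = neighbours-in-one-bag Dt.bag S (Tree.nonempty Dt.T) (λ Nx _ → Dt.cover-V (inj₂ Nx))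
                 (λ Nx Ny x≢y _ _ → Dt.cover-E (inj₂ (Nx , Ny , x≢y)))
    p₂-props = neighbours-in-one-bag D′.bag S (Tree.nonempty D′.T)
                 (λ (Gx , ¬Hx , _) x∉S → D′.cover-V ((Gx , ¬Hx) , x∉S))
                 (λ Nx Ny x≢y x∉S y∉S → D′.cover-E (inj₂ (Nx , Ny , x≢y) , x∉S , y∉S))
    p₁ = proj₁ p₁-props
    p₂ = proj₁ p₂-props
    β₁-V : ∀ a {x} → x ∈ β₁ a → V (delete G S) x
    β₁-V a x∈ with x∈a , x∉S ← ∈-β₁⁻ x∈ with Dt.bag-V a x∈a
    ... | inj₁ Hx = proj₁ H⊆G Hx , x∉S
    ... | inj₂ Nx = proj₁ Nx , x∉S
    cover-V : ∀ {x} → V (delete G S) x → (∃ λ a → x ∈ β₁ a) ⊎ (∃ λ b → x ∈ D′.bag b)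
    cover-V {x} (Gx , x∉S) with V-H? x
    ... | yes Hx = inj₁ (Product.map₂ (λ x∈ → ∈-β₁⁺ x∈ x∉S) (Dt.cover-V (inj₁ Hx)))
    ... | no ¬Hx = inj₂ (D′.cover-V ((Gx , ¬Hx) , x∉S))
    in-torso : ∀ {u v} → E (torso G H) u v → u ∉ S → v ∉ S → ∃ λ a → u ∈ β₁ a × v ∈ β₁ a
    in-torso e u∉S v∉S with a , u∈a , v∈a ← Dt.cover-E e = a , ∈-β₁⁺ u∈a u∉S , ∈-β₁⁺ v∈a v∉S
    cover-E : ∀ {u v} → E (delete G S) u v →
              (∃ λ a → u ∈ β₁ a × v ∈ β₁ a) ⊎ (∃ λ b → u ∈ D′.bag b × v ∈ D′.bag b)
    cover-E {u} {v} (e , u∉S , v∉S) with V-H? u | V-H? v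
    ... | no ¬Hu | no ¬Hv = inj₂ (D′.cover-E (inj₁ (e , (E-V G e , ¬Hu) , (E-V G (E-sym G e) , ¬Hv)) , u∉S , v∉S))
    ... | yes Hu | yes Hv = inj₁ (in-torso (inj₁ (e , inj₁ Hu , inj₁ Hv)) u∉S v∉S)
    ... | yes Hu | no ¬Hv =
      inj₁ (in-torso (inj₁ (e , inj₁ Hu , inj₂ (E-V G (E-sym G e) , ¬Hv , u , Hu , E-sym G e))) u∉S v∉S)
    ... | no ¬Hu | yes Hv = inj₁ (in-torso (inj₁ (e , inj₂ (E-V G e , ¬Hu , v , Hv , e) , inj₁ Hv)) u∉S v∉S)
    coherent₁ : ∀ x {a a′} → x ∈ β₁ a → x ∈ β₁ a′ → WalkIn (Tree.Adj Dt.T) (λ c → x ∈ β₁ c) a a′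
    coherent₁ x xa xa′ =
      weaken (λ x∈ → ∈-β₁⁺ x∈ (proj₂ (∈-β₁⁻ xa))) (Dt.coherent x (proj₁ (∈-β₁⁻ xa)) (proj₁ (∈-β₁⁻ xa′)))
    shared : ∀ {x a b} → x ∈ β₁ a → x ∈ D′.bag b → x ∈ β₁ p₁ × x ∈ D′.bag p₂
    shared {a = a} {b} xa xb with x∈a , x∉S ← ∈-β₁⁻ xa with Dt.bag-V a x∈a
    ... | inj₁ Hx = ⊥-elim (proj₂ (proj₁ (D′.bag-V b xb)) Hx)
    ... | inj₂ Nx = ∈-β₁⁺ (proj₂ p₁-props Nx x∉S) x∉S , proj₂ p₂-props Nx x∉S

  TW≤-reduce : ∀ {k S S′} → (∀ {x} → x ∈ S → ¬ V H x → x ∈ S′) →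
               (∀ {x y} → N x → N y → x ∉ S′ → y ∉ S′ → x ≡ y) →
               TW≤ (delete G S) k → TW≤ (delete G′ S′) k
  TW≤-reduce {S = S} {S′} S∖H⊆S′ one-left = TW≤-restrict (λ x → ¬? (V-H? x) ×-dec ¬? (x ∈? S′)) V⇒ ⇒V E⇒
    where
    ∉S : ∀ {x} → ¬ V H x → x ∉ S′ → x ∉ S
    ∉S ¬Hx x∉S′ x∈S = x∉S′ (S∖H⊆S′ x∈S ¬Hx)
    V⇒ : ∀ {x} → V (delete G′ S′) x → V (delete G S) x × (¬ V H x × x ∉ S′)
    V⇒ ((Gx , ¬Hx) , x∉S′) = (Gx , ∉S ¬Hx x∉S′) , ¬Hx , x∉S′
    ⇒V : ∀ {x} → V (delete G S) x → ¬ V H x × x ∉ S′ → V (delete G′ S′) x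
    ⇒V (Gx , _) (¬Hx , x∉S′) = (Gx , ¬Hx) , x∉S′
    E⇒ : ∀ {u v} → E (delete G′ S′) u v → E (delete G S) u v
    E⇒ (inj₁ (e , (_ , ¬Hu) , (_ , ¬Hv)) , u∉S′ , v∉S′) = e , ∉S ¬Hu u∉S′ , ∉S ¬Hv v∉S′
    E⇒ (inj₂ (Nu , Nv , u≢v) , u∉S′ , v∉S′)             = ⊥-elim (u≢v (one-left Nu Nv u∉S′ v∉S′))

  -- contract V(H) into the neighbour a: bags meeting V(H) lose V(H) and gain a
  module Contraction {k : ℕ} {S : Subset n} (H∩S=∅ : ∀ {x} → V H x → x ∉ S)
                     {a : Fin n} (Na : N a) (a∉S : a ∉ S)
                     (D : TreeDecomposition (delete G S)) (D-width : TreeDecomposition.width≤ D k) where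
    open TreeDecomposition D
    open Tree T using (m; Adj)

    Γ = delete G S

    bag′? : ∀ i → Decidable (λ x → (x ∈ bag i × ¬ V H x) ⊎ (Meets D (V H) i × x ≡ a))
    bag′? i x = ((x ∈? bag i) ×-dec ¬? (V-H? x)) ⊎-dec (meets? D V-H? i ×-dec (x ≟ a))

    bag′ : Fin m → Subset n
    bag′ i = subset (bag′? i)

    Q : Fin n → Set
    Q x = x ≡ a ⊎ V H x

    H-walk-Γ : ∀ {u v} → V H u → V H v → WalkIn (E Γ) Q u v
    H-walk-Γ Hu Hv = weaken inj₂ (mapEdges (λ Hx Hy e → e , H∩S=∅ Hx , H∩S=∅ Hy) (H-walk Hu Hv))

    Q-connected : ∀ {q q′} → Q q → Q q′ → WalkIn (E Γ) Q q q′
    Q-connected (inj₁ refl) (inj₁ refl) = here (inj₁ refl)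
    Q-connected (inj₁ refl) (inj₂ Hq)   = let _ , _ , h , Hh , ah = Na in
      step (inj₁ refl) (ah , a∉S , H∩S=∅ Hh) (H-walk-Γ Hh Hq)
    Q-connected (inj₂ Hq)   (inj₁ refl) = reverse (E-sym Γ) (Q-connected (inj₁ refl) (inj₂ Hq))
    Q-connected (inj₂ Hq)   (inj₂ Hq′)  = H-walk-Γ Hq Hq′

    a∈bag′⇒meets : ∀ {i} → a ∈ bag′ i → Meets D Q i
    a∈bag′⇒meets {i} a∈ with ∈-subset⁻ (bag′? i) a∈
    ... | inj₁ (a∈i , _)             = a , inj₁ refl , a∈i
    ... | inj₂ ((q , Hq , q∈i) , _) = q , inj₂ Hq , q∈i

    meets⇒a∈bag′ : ∀ {i} → Meets D Q i → a ∈ bag′ i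
    meets⇒a∈bag′ {i} (_ , inj₁ refl , a∈i) = ∈-subset⁺ (bag′? i) (inj₁ (a∈i , proj₁ (proj₂ Na)))
    meets⇒a∈bag′ {i} (q , inj₂ Hq , q∈i)   = ∈-subset⁺ (bag′? i) (inj₂ ((q , Hq , q∈i) , refl))

    a-and : ∀ {y} → N y → y ∉ S → ∃ λ i → a ∈ bag′ i × y ∈ bag′ i
    a-and (_ , ¬Hy , h , Hh , yh) y∉S with i , y∈i , h∈i ← cover-E (yh , y∉S , H∩S=∅ Hh) =
      i , ∈-subset⁺ (bag′? i) (inj₂ ((h , Hh , h∈i) , refl)) , ∈-subset⁺ (bag′? i) (inj₁ (y∈i , ¬Hy))

    cover-E′ : ∀ {u v} → E (delete G′ S) u v → ∃ λ i → u ∈ bag′ i × v ∈ bag′ i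
    cover-E′ (inj₁ (e , (_ , ¬Hu) , (_ , ¬Hv)) , u∉S , v∉S) with i , u∈i , v∈i ← cover-E (e , u∉S , v∉S) =
      i , ∈-subset⁺ (bag′? i) (inj₁ (u∈i , ¬Hu)) , ∈-subset⁺ (bag′? i) (inj₁ (v∈i , ¬Hv))
    cover-E′ {u} {v} (inj₂ (Nu , Nv , u≢v) , u∉S , v∉S) with u ≟ a | v ≟ a
    ... | yes refl | _        = a-and Nv v∉S
    ... | no _     | yes refl = Product.map₂ Product.swap (a-and Nu u∉S)
    ... | no u≢a   | no v≢a   = ⊥-elim (u≢v (neighbours-besides Na Nu Nv u≢a v≢a))

    coherent′ : ∀ x {i j} → x ∈ bag′ i → x ∈ bag′ j → WalkIn Adj (λ c → x ∈ bag′ c) i j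
    coherent′ x {i} {j} xi xj with x ≟ a | ∈-subset⁻ (bag′? i) xi | ∈-subset⁻ (bag′? j) xj
    ... | yes refl | _ | _ = weaken meets⇒a∈bag′ (meets-connected D Q-connected (a∈bag′⇒meets xi) (a∈bag′⇒meets xj))
    ... | no x≢a | inj₂ (_ , x≡a) | _ = ⊥-elim (x≢a x≡a)
    ... | no x≢a | _ | inj₂ (_ , x≡a) = ⊥-elim (x≢a x≡a)
    ... | no _ | inj₁ (x∈i , ¬Hx) | inj₁ (x∈j , _) =
      weaken (λ x∈ → ∈-subset⁺ (bag′? _) (inj₁ (x∈ , ¬Hx))) (coherent x x∈i x∈j)

    width′ : ∀ i → ∣ bag′ i ∣ ≤ suc k
    width′ i = by-cases (meets? D V-H? i)
      where
      by-cases : Dec (Meets D (V H) i) → ∣ bag′ i ∣ ≤ suc k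
      by-cases (yes (h , Hh , h∈i)) = ≤-trans (p⊆q-x∪⁅y⁆⇒∣p∣≤∣q∣ h∈i exchange) (D-width i)
        where
        exchange : ∀ {z} → z ∈ bag′ i → (z ∈ bag i × z ≢ h) ⊎ z ≡ a
        exchange z∈ with ∈-subset⁻ (bag′? i) z∈
        ... | inj₁ (z∈i , ¬Hz) = inj₁ (z∈i , λ { refl → ¬Hz Hh })
        ... | inj₂ (_ , z≡a)   = inj₂ z≡a
      by-cases (no ¬meets) = ≤-trans (p⊆q⇒∣p∣≤∣q∣ only-old) (D-width i)
        where
        only-old : bag′ i ⊆ bag i
        only-old z∈ with ∈-subset⁻ (bag′? i) z∈
        ... | inj₁ (z∈i , _)   = z∈i
        ... | inj₂ (meets , _) = ⊥-elim (¬meets meets)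

    contracted : TW≤ (delete G′ S) k
    contracted = record
      { T        = T
      ; bag      = bag′
      ; bag-V    = bag′-V
      ; cover-V  = λ ((Gx , ¬Hx) , x∉S) →
                     Product.map₂ (λ x∈ → ∈-subset⁺ (bag′? _) (inj₁ (x∈ , ¬Hx))) (cover-V (Gx , x∉S))
      ; cover-E  = cover-E′
      ; coherent = coherent′
      } , width′
      where
      bag′-V : ∀ i {x} → x ∈ bag′ i → V (delete G′ S) x
      bag′-V i x∈ with ∈-subset⁻ (bag′? i) x∈
      ... | inj₁ (x∈i , ¬Hx) = (proj₁ (bag-V i x∈i) , ¬Hx) , proj₂ (bag-V i x∈i)
      ... | inj₂ (_ , refl)  = (proj₁ Na , proj₁ (proj₂ Na)) , a∉S

  module _ {t : ℕ} {S : Subset n} (S⊆G : ∀ {x} → x ∈ S → V G x) (|S|≤t : ∣ S ∣ ≤ t) (S-tw : TW≤ (delete G S) 2) where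

    forward-N⊆S : (∀ {x} → N x → x ∈ S) → TW2D≤ G′ t
    forward-N⊆S N⊆S =
      S′ , (λ x∈ → let x∈S , ¬Hx = ∈-S′⁻ x∈ in S⊆G x∈S , ¬Hx) , ≤-trans (p⊆q⇒∣p∣≤∣q∣ (proj₁ ∘ ∈-S′⁻)) |S|≤t ,
      TW≤-reduce (λ x∈S ¬Hx → ∈-subset⁺ S′? (x∈S , ¬Hx))
                 (λ Nx _ x∉S′ _ → ⊥-elim (x∉S′ (∈-subset⁺ S′? (N⊆S Nx , proj₁ (proj₂ Nx))))) S-tw
      where
      S′? : Decidable (λ x → x ∈ S × ¬ V H x)
      S′? x = (x ∈? S) ×-dec ¬? (V-H? x)
      S′ = subset S′?
      ∈-S′⁻ = ∈-subset⁻ S′?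

    forward-contract : ∀ {a} → (∀ {x} → V H x → x ∉ S) → N a → a ∉ S → TW2D≤ G′ t
    forward-contract H∩S=∅ Na a∉S =
      S , (λ x∈S → S⊆G x∈S , λ Hx → H∩S=∅ Hx x∈S) , |S|≤t ,
      Contraction.contracted H∩S=∅ Na a∉S (proj₁ S-tw) (proj₂ S-tw)

    -- trade a vertex h ∈ S ∩ V(H) for the neighbour a
    forward-exchange : ∀ {h a} → h ∈ S → V H h → N a → TW2D≤ G′ t
    forward-exchange {h} {a} h∈S Hh Na@(Ga , ¬Ha , _) =
      S′ , S′⊆G′ , ≤-trans (p⊆q-x∪⁅y⁆⇒∣p∣≤∣q∣ h∈S exchange) |S|≤t ,
      TW≤-reduce (λ x∈S ¬Hx → ∈-subset⁺ S′? (inj₁ (x∈S , ¬Hx)))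
                 (λ Nx Ny x∉S′ y∉S′ → neighbours-besides Na Nx Ny (≢a x∉S′) (≢a y∉S′)) S-tw
      where
      S′? : Decidable (λ x → (x ∈ S × ¬ V H x) ⊎ x ≡ a)
      S′? x = ((x ∈? S) ×-dec ¬? (V-H? x)) ⊎-dec (x ≟ a)
      S′ = subset S′?
      ≢a : ∀ {x} → x ∉ S′ → x ≢ a
      ≢a x∉S′ x≡a = x∉S′ (∈-subset⁺ S′? (inj₂ x≡a))
      S′⊆G′ : ∀ {x} → x ∈ S′ → V G′ x
      S′⊆G′ x∈ with ∈-subset⁻ S′? x∈
      ... | inj₁ (x∈S , ¬Hx) = S⊆G x∈S , ¬Hx
      ... | inj₂ refl        = Ga , ¬Ha
      exchange : ∀ {x} → x ∈ S′ → (x ∈ S × x ≢ h) ⊎ x ≡ a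
      exchange x∈ with ∈-subset⁻ S′? x∈
      ... | inj₁ (x∈S , ¬Hx) = inj₁ (x∈S , λ { refl → ¬Hx Hh })
      ... | inj₂ x≡a         = inj₂ x≡a

  forward : ∀ {t} → TW2D≤ G t → TW2D≤ G′ t
  forward (S , S⊆G , |S|≤t , S-tw) with any? (λ x → N? x ×-dec ¬? (x ∈? S))
  ... | no none = forward-N⊆S S⊆G |S|≤t S-tw (λ {x} Nx → decidable-stable (x ∈? S) (λ x∉S → none (x , Nx , x∉S)))
  ... | yes (a , Na , a∉S) with any? (λ x → (x ∈? S) ×-dec V-H? x)
  ...   | yes (h , h∈S , Hh) = forward-exchange S⊆G |S|≤t S-tw h∈S Hh Na
  ...   | no H∩S=∅           = forward-contract S⊆G |S|≤t S-tw (λ Hx x∈S → H∩S=∅ (_ , x∈S , Hx)) Na a∉S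

  backward : ∀ {t} → TW2D≤ G′ t → TW2D≤ G t
  backward (S , S⊆G′ , |S|≤t , S-tw) = S , proj₁ ∘ S⊆G′ , |S|≤t , TW≤-unreduce S-tw

lemma3p5 : ∀ {n} (G H : Graph n) (t : ℕ) →
    SubgraphOf H G → NonEmpty H → Connected H →
    TW≤ (torso G H) 2 →
    (TW2D≤ G t → TW2D≤ (reduce G H) t) × (TW2D≤ (reduce G H) t → TW2D≤ G t)
lemma3p5 G H t H⊆G _ H-connected (Dt , Dt-width) =
  Reduction.forward G H H⊆G H-connected Dt Dt-width , Reduction.backward G H H⊆G H-connected Dt Dt-width
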